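{- There exist infinitely many unicyclic graphs $G$ whose set of vertex degrees is exactly $\{1,2,\Delta\}$ for some $\Delta\ge 3$ and which satisfy $$S(G)=IRD(G)=\frac{2N_\Delta N_1}{N_\Delta+N_1}(\Delta-1)=2N_1.$$
   Context: A unicyclic graph is a connected graph with exactly as many edges as vertices. $N_i$ is the number of vertices of degree $i$. For a graph with $n$ vertices, $m$ edges and degrees $d_1,\dots,d_n$, $S(G)=\sum_i|d_i-\frac{2m}{n}|$; $IRD(G)=\frac{2N_\Delta N_\delta}{N_\delta+N_\Delta}(\Delta-\delta)$ with $\Delta,\delta$ the maximum and minimum degree (here $\delta=1$). -}

module Defs where

open import Data.Bool using (Bool; true; false; if_then_else_)
open import Data.Nat as ℕ using (ℕ; zero; suc; _⊔_; _⊓_; _<ᵇ_; _≡ᵇ_)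
open import Data.Fin using (Fin; toℕ)
open import Data.List using (List; map; foldr; allFin)
open import Data.Nat.ListAction using (sum)
open import Data.Integer using (ℤ; +_)
open import Data.Rational using (ℚ; 0ℚ; _/_; ∣_∣; _-_; _*_; _+_)
open import Relation.Binary.PropositionalEquality using (_≡_)
open import Data.Product using (_×_)

-- rational division by a natural number (0 when the denominator is 0)
divℕ : ℚ → ℕ → ℚ
divℕ p zero    = 0ℚ
divℕ p (suc k) = p * ((+ 1) / suc k)

ℕ→ℚ : ℕ → ℚ
ℕ→ℚ k = (+ k) / 1

record Graph (n : ℕ) : Set where
  field
    adj     : Fin n → Fin n → Bool
    adj-sym : ∀ i j → adj i j ≡ adj j i
    irrefl  : ∀ i → adj i i ≡ false
open Graph public

module _ {n : ℕ} (G : Graph n) where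

  deg : Fin n → ℕ
  deg i = sum (map (λ j → if adj G i j then 1 else 0) (allFin n))

  edgeCount : ℕ
  edgeCount = sum (map (λ i → sum (map (λ j →
                if (toℕ i <ᵇ toℕ j) then (if adj G i j then 1 else 0) else 0)
                (allFin n))) (allFin n))

  data Walk : Fin n → Fin n → Set where
    here : ∀ {i} → Walk i i
    step : ∀ {i j k} → adj G i j ≡ true → Walk j k → Walk i k

  Connected : Set
  Connected = ∀ i j → Walk i j

  Unicyclic : Set
  Unicyclic = Connected × (edgeCount ≡ n)

  N : ℕ → ℕ
  N k = sum (map (λ i → if deg i ≡ᵇ k then 1 else 0) (allFin n))

  -- maximum and minimum degree (both 0 for the empty graph)
  maxDeg : ℕ
  maxDeg = foldr _⊔_ 0 (map deg (allFin n))

  minDeg : ℕ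
  minDeg = foldr _⊓_ maxDeg (map deg (allFin n))

  S : ℚ
  S = foldr _+_ 0ℚ (map (λ i → ∣ ℕ→ℚ (deg i) - divℕ (ℕ→ℚ (2 ℕ.* edgeCount)) n ∣) (allFin n))

  IRD : ℚ
  IRD = divℕ (ℕ→ℚ (2 ℕ.* N maxDeg ℕ.* N minDeg)) (N minDeg ℕ.+ N maxDeg)
        * (ℕ→ℚ maxDeg - ℕ→ℚ minDeg)

{-# OPTIONS --safe #-}
module Submission where

-- Take the cone over an edge together with k + 1 isolated vertices: a triangle with k + 1
-- pendant vertices at one corner. It has n = m = k + 4, so the average degree is 2 and
-- S = Σ |dᵢ - 2| = (k + 1) + (k + 1) = 2 N₁. The apex is the only vertex of maximum degree
-- Δ = k + 3, so IRD = 2 N₁ / (1 + N₁) · (Δ - 1) = 2 N₁ because Δ - 1 = N₁ + 1.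

open import Defs
open import Algebra.Definitions using (Associative; Idempotent)
open import Data.Bool using (Bool; true; false; if_then_else_)
open import Data.Bool.Properties using (T-≡; if-eta)
open import Data.Fin using (Fin; zero; suc; toℕ)
open import Data.Integer as ℤ using (+_)
import Data.Integer.Properties as ℤ
open import Data.List using (List; []; _∷_; map; foldr; allFin; tabulate; replicate)
import Data.List.Properties as List
open import Data.Nat as ℕ using (ℕ; _≥_; _*_; _+_; _⊔_; _⊓_; _<ᵇ_; _≡ᵇ_)
import Data.Nat.Properties as ℕ
open import Data.Nat.ListAction using (sum)
open import Data.Product using (Σ; _×_; ∃; _,_)
open import Data.Rational as ℚ using (ℚ; 0ℚ; 1ℚ; fromℚᵘ)
import Data.Rational.Properties as ℚ
open import Data.Rational.Solver using (module +-*-Solver)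
open import Data.Rational.Unnormalised as ℚᵘ using (ℚᵘ; mkℚᵘ; *≡*)
import Data.Rational.Unnormalised.Properties as ℚᵘ
open import Data.Sum using (_⊎_; inj₁; inj₂)
open import Function using (_∘_; Equivalence)
open import Relation.Binary.PropositionalEquality
  using (_≡_; refl; sym; trans; cong; cong₂; module ≡-Reasoning)

fromℚᵘ-homo-+ : ∀ p q → fromℚᵘ (p ℚᵘ.+ q) ≡ fromℚᵘ p ℚ.+ fromℚᵘ q
fromℚᵘ-homo-+ p q = ℚ.toℚᵘ-injective (ℚᵘ.≃-trans (ℚ.toℚᵘ-fromℚᵘ (p ℚᵘ.+ q))
  (ℚᵘ.≃-sym (ℚᵘ.≃-trans (ℚ.toℚᵘ-homo-+ (fromℚᵘ p) (fromℚᵘ q))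
                        (ℚᵘ.+-cong (ℚ.toℚᵘ-fromℚᵘ p) (ℚ.toℚᵘ-fromℚᵘ q)))))

fromℚᵘ-homo-* : ∀ p q → fromℚᵘ (p ℚᵘ.* q) ≡ fromℚᵘ p ℚ.* fromℚᵘ q
fromℚᵘ-homo-* p q = ℚ.toℚᵘ-injective (ℚᵘ.≃-trans (ℚ.toℚᵘ-fromℚᵘ (p ℚᵘ.* q))
  (ℚᵘ.≃-sym (ℚᵘ.≃-trans (ℚ.toℚᵘ-homo-* (fromℚᵘ p) (fromℚᵘ q))
                        (ℚᵘ.*-cong (ℚ.toℚᵘ-fromℚᵘ p) (ℚ.toℚᵘ-fromℚᵘ q)))))

fromℚᵘ-homo-∣-∣ : ∀ p → fromℚᵘ ℚᵘ.∣ p ∣ ≡ ℚ.∣ fromℚᵘ p ∣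
fromℚᵘ-homo-∣-∣ p = ℚ.toℚᵘ-injective (ℚᵘ.≃-trans (ℚ.toℚᵘ-fromℚᵘ ℚᵘ.∣ p ∣)
  (ℚᵘ.≃-sym (ℚᵘ.≃-trans (ℚ.toℚᵘ-homo-∣-∣ (fromℚᵘ p)) (ℚᵘ.∣-∣-cong (ℚ.toℚᵘ-fromℚᵘ p)))))

-- ℕ→ℚ n and (+ 1) / suc d are definitionally fromℚᵘ (mkℚᵘ (+ n) 0) and fromℚᵘ (mkℚᵘ (+ 1) d),
-- so their arithmetic is transported from ℚᵘ, where it is a computation on numerators.

ℕ→ℚ-+ : ∀ m n → ℕ→ℚ (m + n) ≡ ℕ→ℚ m ℚ.+ ℕ→ℚ n
ℕ→ℚ-+ m n = trans (ℚ.fromℚᵘ-cong {mkℚᵘ (+ (m + n)) 0} {m′ ℚᵘ.+ n′} (*≡* numerators))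
                  (fromℚᵘ-homo-+ m′ n′)
  where
  open ≡-Reasoning
  m′ n′ : ℚᵘ
  m′ = mkℚᵘ (+ m) 0
  n′ = mkℚᵘ (+ n) 0
  numerators : + (m + n) ℤ.* + 1 ≡ (+ m ℤ.* + 1 ℤ.+ + n ℤ.* + 1) ℤ.* + 1
  numerators = begin
    + (m + n) ℤ.* + 1                      ≡⟨ ℤ.*-identityʳ _ ⟩
    + (m + n)                              ≡⟨ ℤ.pos-+ m n ⟩
    + m ℤ.+ + n                            ≡⟨ cong₂ ℤ._+_ (ℤ.*-identityʳ (+ m)) (ℤ.*-identityʳ (+ n)) ⟨
    + m ℤ.* + 1 ℤ.+ + n ℤ.* + 1            ≡⟨ ℤ.*-identityʳ _ ⟨
    (+ m ℤ.* + 1 ℤ.+ + n ℤ.* + 1) ℤ.* + 1  ∎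

ℕ→ℚ-* : ∀ m n → ℕ→ℚ (m * n) ≡ ℕ→ℚ m ℚ.* ℕ→ℚ n
ℕ→ℚ-* m n = trans (ℚ.fromℚᵘ-cong {mkℚᵘ (+ (m * n)) 0} {m′ ℚᵘ.* n′} (*≡* (cong (ℤ._* + 1) (ℤ.pos-* m n))))
                  (fromℚᵘ-homo-* m′ n′)
  where
  m′ n′ : ℚᵘ
  m′ = mkℚᵘ (+ m) 0
  n′ = mkℚᵘ (+ n) 0

∣ℕ→ℚ∣ : ∀ n → ℚ.∣ ℕ→ℚ n ∣ ≡ ℕ→ℚ n
∣ℕ→ℚ∣ n = sym (fromℚᵘ-homo-∣-∣ (mkℚᵘ (+ n) 0))

ℕ→ℚ-+-cancelˡ : ∀ m n → ℕ→ℚ (m + n) ℚ.- ℕ→ℚ m ≡ ℕ→ℚ n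
ℕ→ℚ-+-cancelˡ m n = trans (cong (ℚ._- ℕ→ℚ m) (ℕ→ℚ-+ m n)) (+-cancelˡ (ℕ→ℚ m) (ℕ→ℚ n))
  where
  open +-*-Solver
  +-cancelˡ : ∀ x y → (x ℚ.+ y) ℚ.- x ≡ y
  +-cancelˡ = solve 2 (λ x y → (x :+ y) :- x := y) refl

ℕ→ℚ-∣-∣ : ∀ m n → ℚ.∣ ℕ→ℚ m ℚ.- ℕ→ℚ n ∣ ≡ ℕ→ℚ ℕ.∣ m - n ∣
ℕ→ℚ-∣-∣ ℕ.zero    n         = trans (cong ℚ.∣_∣ (ℚ.+-identityˡ (ℚ.- ℕ→ℚ n)))
                                    (trans (ℚ.∣-p∣≡∣p∣ (ℕ→ℚ n)) (∣ℕ→ℚ∣ n))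
ℕ→ℚ-∣-∣ (ℕ.suc m) ℕ.zero    = trans (cong ℚ.∣_∣ (ℚ.+-identityʳ (ℕ→ℚ (ℕ.suc m)))) (∣ℕ→ℚ∣ (ℕ.suc m))
ℕ→ℚ-∣-∣ (ℕ.suc m) (ℕ.suc n) = begin
  ℚ.∣ ℕ→ℚ (1 + m) ℚ.- ℕ→ℚ (1 + n) ∣        ≡⟨ cong ℚ.∣_∣ (cong₂ ℚ._-_ (ℕ→ℚ-+ 1 m) (ℕ→ℚ-+ 1 n)) ⟩
  ℚ.∣ (1ℚ ℚ.+ ℕ→ℚ m) ℚ.- (1ℚ ℚ.+ ℕ→ℚ n) ∣  ≡⟨ cong ℚ.∣_∣ (shift 1ℚ (ℕ→ℚ m) (ℕ→ℚ n)) ⟩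
  ℚ.∣ ℕ→ℚ m ℚ.- ℕ→ℚ n ∣                    ≡⟨ ℕ→ℚ-∣-∣ m n ⟩
  ℕ→ℚ ℕ.∣ m - n ∣                          ∎
  where
  open ≡-Reasoning
  open +-*-Solver
  shift : ∀ c x y → (c ℚ.+ x) ℚ.- (c ℚ.+ y) ≡ x ℚ.- y
  shift = solve 3 (λ c x y → (c :+ x) :- (c :+ y) := x :- y) refl

ℕ→ℚ-sum : ∀ ns → foldr ℚ._+_ 0ℚ (map ℕ→ℚ ns) ≡ ℕ→ℚ (sum ns)
ℕ→ℚ-sum []       = refl
ℕ→ℚ-sum (n ∷ ns) = trans (cong (ℕ→ℚ n ℚ.+_) (ℕ→ℚ-sum ns)) (sym (ℕ→ℚ-+ n (sum ns)))

1/suc-inverseˡ : ∀ d → (+ 1 ℚ./ ℕ.suc d) ℚ.* ℕ→ℚ (ℕ.suc d) ≡ 1ℚ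
1/suc-inverseˡ d = trans (sym (fromℚᵘ-homo-* (ℚᵘ.1/ d′) d′))
                         (ℚ.fromℚᵘ-cong {ℚᵘ.1/ d′ ℚᵘ.* d′} {ℚᵘ.1ℚᵘ} (ℚᵘ.*-inverseˡ d′))
  where
  d′ : ℚᵘ
  d′ = mkℚᵘ (+ ℕ.suc d) 0

divℕ-*-cancel : ∀ p d → divℕ p (ℕ.suc d) ℚ.* ℕ→ℚ (ℕ.suc d) ≡ p
divℕ-*-cancel p d = begin
  p ℚ.* (+ 1 ℚ./ ℕ.suc d) ℚ.* ℕ→ℚ (ℕ.suc d)    ≡⟨ ℚ.*-assoc p _ _ ⟩
  p ℚ.* ((+ 1 ℚ./ ℕ.suc d) ℚ.* ℕ→ℚ (ℕ.suc d))  ≡⟨ cong (p ℚ.*_) (1/suc-inverseˡ d) ⟩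
  p ℚ.* 1ℚ                                     ≡⟨ ℚ.*-identityʳ p ⟩
  p                                            ∎
  where open ≡-Reasoning

*-divℕ-cancel : ∀ p d → divℕ (p ℚ.* ℕ→ℚ (ℕ.suc d)) (ℕ.suc d) ≡ p
*-divℕ-cancel p d = begin
  p ℚ.* ℕ→ℚ (ℕ.suc d) ℚ.* (+ 1 ℚ./ ℕ.suc d)    ≡⟨ ℚ.*-assoc p _ _ ⟩
  p ℚ.* (ℕ→ℚ (ℕ.suc d) ℚ.* (+ 1 ℚ./ ℕ.suc d))  ≡⟨ cong (p ℚ.*_) (trans (ℚ.*-comm (ℕ→ℚ (ℕ.suc d)) _) (1/suc-inverseˡ d)) ⟩
  p ℚ.* 1ℚ                                     ≡⟨ ℚ.*-identityʳ p ⟩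
  p                                            ∎
  where open ≡-Reasoning

tabulate-const : ∀ {A : Set} {m} (f : Fin m → A) {x} → (∀ j → f j ≡ x) → tabulate f ≡ replicate m x
tabulate-const {m = ℕ.zero}  f p = refl
tabulate-const {m = ℕ.suc m} f p = cong₂ _∷_ (p zero) (tabulate-const (f ∘ suc) (p ∘ suc))

sum-replicate : ∀ m x → sum (replicate m x) ≡ m * x
sum-replicate ℕ.zero    x = refl
sum-replicate (ℕ.suc m) x = cong (_+_ x) (sum-replicate m x)

sum-tabulate-const : ∀ {m} (f : Fin m → ℕ) {x} → (∀ j → f j ≡ x) → sum (tabulate f) ≡ m * x
sum-tabulate-const {m} f {x} p = trans (cong sum (tabulate-const f p)) (sum-replicate m x)

sum-tabulate-zero : ∀ {m} (f : Fin m → ℕ) → (∀ j → f j ≡ 0) → sum (tabulate f) ≡ 0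
sum-tabulate-zero {m} f p = trans (sum-tabulate-const f p) (ℕ.*-zeroʳ m)

sum-map-allFin : ∀ {m} (f : Fin m → ℕ) → sum (map f (allFin m)) ≡ sum (tabulate f)
sum-map-allFin f = cong sum (List.map-tabulate (λ i → i) f)

foldr-replicate : ∀ {A : Set} (_∙_ : A → A → A) → Associative _≡_ _∙_ → Idempotent _≡_ _∙_ →
                  ∀ m x e → foldr _∙_ e (replicate (ℕ.suc m) x) ≡ x ∙ e
foldr-replicate _∙_ assoc idem ℕ.zero    x e = refl
foldr-replicate _∙_ assoc idem (ℕ.suc m) x e = begin
  x ∙ foldr _∙_ e (replicate (ℕ.suc m) x)  ≡⟨ cong (x ∙_) (foldr-replicate _∙_ assoc idem m x e) ⟩
  x ∙ (x ∙ e)                              ≡⟨ assoc x x e ⟨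
  (x ∙ x) ∙ e                              ≡⟨ cong (_∙ e) (idem x) ⟩
  x ∙ e                                    ∎
  where open ≡-Reasoning

≡ᵇ-refl : ∀ m → (m ≡ᵇ m) ≡ true
≡ᵇ-refl m = Equivalence.to T-≡ (ℕ.≡⇒≡ᵇ m m refl)

indicator : ℕ → ℕ → ℕ
indicator x d = if d ≡ᵇ x then 1 else 0

count : ℕ → List ℕ → ℕ
count x ds = sum (map (indicator x) ds)

module _ {n : ℕ} (G : Graph n) where

  degrees : List ℕ
  degrees = map (deg G) (allFin n)

  deg-tabulate : ∀ i → deg G i ≡ sum (tabulate (λ j → if adj G i j then 1 else 0))
  deg-tabulate i = sum-map-allFin (λ j → if adj G i j then 1 else 0)

  edgeCount-tabulate : edgeCount G ≡ sum (tabulate (λ i → sum (tabulate (λ j →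
                         if toℕ i <ᵇ toℕ j then (if adj G i j then 1 else 0) else 0))))
  edgeCount-tabulate = trans (sum-map-allFin forwardDegree)
                             (cong sum (List.tabulate-cong (λ i → sum-map-allFin (entry i))))
    where
    entry : Fin n → Fin n → ℕ
    entry i j = if toℕ i <ᵇ toℕ j then (if adj G i j then 1 else 0) else 0
    forwardDegree : Fin n → ℕ
    forwardDegree i = sum (map (entry i) (allFin n))

  N-degrees : ∀ x → N G x ≡ count x degrees
  N-degrees x = cong sum (List.map-∘ (allFin n))

  IRD-extremes : ∀ {Δ δ} → maxDeg G ≡ Δ → minDeg G ≡ δ →
                 IRD G ≡ divℕ (ℕ→ℚ (2 * N G Δ * N G δ)) (N G Δ + N G δ) ℚ.* (ℕ→ℚ Δ ℚ.- ℕ→ℚ δ)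
  IRD-extremes {Δ} {δ} refl refl =
    cong (λ s → divℕ (ℕ→ℚ (2 * N G Δ * N G δ)) s ℚ.* (ℕ→ℚ Δ ℚ.- ℕ→ℚ δ)) (ℕ.+-comm (N G δ) (N G Δ))

averageDegree : ∀ {m} (G : Graph (ℕ.suc m)) → edgeCount G ≡ ℕ.suc m →
                divℕ (ℕ→ℚ (2 * edgeCount G)) (ℕ.suc m) ≡ ℕ→ℚ 2
averageDegree {m} G e = begin
  divℕ (ℕ→ℚ (2 * edgeCount G)) (ℕ.suc m)        ≡⟨ cong (λ x → divℕ (ℕ→ℚ (2 * x)) (ℕ.suc m)) e ⟩
  divℕ (ℕ→ℚ (2 * ℕ.suc m)) (ℕ.suc m)            ≡⟨ cong (λ x → divℕ x (ℕ.suc m)) (ℕ→ℚ-* 2 (ℕ.suc m)) ⟩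
  divℕ (ℕ→ℚ 2 ℚ.* ℕ→ℚ (ℕ.suc m)) (ℕ.suc m)      ≡⟨ *-divℕ-cancel (ℕ→ℚ 2) m ⟩
  ℕ→ℚ 2                                         ∎
  where open ≡-Reasoning

S-unicyclic : ∀ {m} (G : Graph (ℕ.suc m)) → edgeCount G ≡ ℕ.suc m →
              S G ≡ ℕ→ℚ (sum (map (λ d → ℕ.∣ d - 2 ∣) (degrees G)))
S-unicyclic {m} G e = begin
  S G
    ≡⟨ cong (λ c → Σℚ (map (λ i → ℚ.∣ ℕ→ℚ (deg G i) ℚ.- c ∣) vs)) (averageDegree G e) ⟩
  Σℚ (map (λ i → ℚ.∣ ℕ→ℚ (deg G i) ℚ.- ℕ→ℚ 2 ∣) vs)
    ≡⟨ cong Σℚ (List.map-cong {f = λ i → ℚ.∣ ℕ→ℚ (deg G i) ℚ.- ℕ→ℚ 2 ∣} {g = ℕ→ℚ ∘ dist2 ∘ deg G}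
                              (λ i → ℕ→ℚ-∣-∣ (deg G i) 2) vs) ⟩
  Σℚ (map (ℕ→ℚ ∘ dist2 ∘ deg G) vs)
    ≡⟨ cong Σℚ (List.map-∘ {g = ℕ→ℚ} {f = dist2 ∘ deg G} vs) ⟩
  Σℚ (map ℕ→ℚ (map (dist2 ∘ deg G) vs))
    ≡⟨ cong (Σℚ ∘ map ℕ→ℚ) (List.map-∘ {g = dist2} {f = deg G} vs) ⟩
  Σℚ (map ℕ→ℚ (map dist2 (degrees G)))
    ≡⟨ ℕ→ℚ-sum (map dist2 (degrees G)) ⟩
  ℕ→ℚ (sum (map dist2 (degrees G)))
    ∎
  where
  open ≡-Reasoning
  Σℚ : List ℚ → ℚ
  Σℚ = foldr ℚ._+_ 0ℚ
  vs : List (Fin (ℕ.suc m))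
  vs = allFin (ℕ.suc m)
  dist2 : ℕ → ℕ
  dist2 d = ℕ.∣ d - 2 ∣

module _ {m : ℕ} where

  edge01 : Fin m → Fin m → Bool
  edge01 zero       (suc zero) = true
  edge01 (suc zero) zero       = true
  edge01 _          _          = false

  edge01-sym : ∀ i j → edge01 i j ≡ edge01 j i
  edge01-sym zero          zero          = refl
  edge01-sym zero          (suc zero)    = refl
  edge01-sym zero          (suc (suc _)) = refl
  edge01-sym (suc zero)    zero          = refl
  edge01-sym (suc (suc _)) zero          = refl
  edge01-sym (suc zero)    (suc zero)    = refl
  edge01-sym (suc zero)    (suc (suc _)) = refl
  edge01-sym (suc (suc _)) (suc zero)    = refl
  edge01-sym (suc (suc _)) (suc (suc _)) = refl

  edge01-irrefl : ∀ i → edge01 i i ≡ false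
  edge01-irrefl zero          = refl
  edge01-irrefl (suc zero)    = refl
  edge01-irrefl (suc (suc _)) = refl

singleEdge : ∀ m → Graph m
singleEdge m = record { adj = edge01 ; adj-sym = edge01-sym ; irrefl = edge01-irrefl }

module _ {m : ℕ} (G : Graph m) where

  coneAdj : Fin (ℕ.suc m) → Fin (ℕ.suc m) → Bool
  coneAdj zero    zero    = false
  coneAdj zero    (suc _) = true
  coneAdj (suc _) zero    = true
  coneAdj (suc i) (suc j) = adj G i j

  coneAdj-sym : ∀ i j → coneAdj i j ≡ coneAdj j i
  coneAdj-sym zero    zero    = refl
  coneAdj-sym zero    (suc _) = refl
  coneAdj-sym (suc _) zero    = refl
  coneAdj-sym (suc i) (suc j) = adj-sym G i j

  coneAdj-irrefl : ∀ i → coneAdj i i ≡ false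
  coneAdj-irrefl zero    = refl
  coneAdj-irrefl (suc i) = irrefl G i

cone : ∀ {m} → Graph m → Graph (ℕ.suc m)
cone G = record { adj = coneAdj G ; adj-sym = coneAdj-sym G ; irrefl = coneAdj-irrefl G }

cone-connected : ∀ {m} (G : Graph m) → Connected (cone G)
cone-connected G zero    j = from-apex j
  where
  from-apex : ∀ j → Walk (cone G) zero j
  from-apex zero    = here
  from-apex (suc j) = step refl here
cone-connected G (suc i) j = step refl (cone-connected G zero j)

module PendantTriangle (k : ℕ) where

  open ≡-Reasoning

  T : Graph (4 + k)
  T = cone (singleEdge (3 + k))

  Δ : ℕ
  Δ = 3 + k

  leaf : Fin (ℕ.suc k) → Fin (4 + k)
  leaf i = suc (suc (suc i))

  row : Fin (4 + k) → Fin (4 + k) → ℕ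
  row i j = if adj T i j then 1 else 0

  deg-apex : deg T zero ≡ Δ
  deg-apex = begin
    deg T zero                           ≡⟨ deg-tabulate T zero ⟩
    0 + sum (tabulate (row zero ∘ suc))  ≡⟨ sum-tabulate-const (row zero ∘ suc) (λ _ → refl) ⟩
    Δ * 1                                ≡⟨ ℕ.*-identityʳ Δ ⟩
    Δ                                    ∎

  deg-corner₁ : deg T (suc zero) ≡ 2
  deg-corner₁ = begin
    deg T (suc zero)                                         ≡⟨ deg-tabulate T (suc zero) ⟩
    1 + (0 + (1 + sum (tabulate (row (suc zero) ∘ leaf))))
      ≡⟨ cong (λ s → 1 + (0 + (1 + s))) (sum-tabulate-zero (row (suc zero) ∘ leaf) (λ _ → refl)) ⟩
    2                                                        ∎

  deg-corner₂ : deg T (suc (suc zero)) ≡ 2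
  deg-corner₂ = begin
    deg T (suc (suc zero))                                       ≡⟨ deg-tabulate T (suc (suc zero)) ⟩
    1 + (1 + (0 + sum (tabulate (row (suc (suc zero)) ∘ leaf))))
      ≡⟨ cong (λ s → 1 + (1 + (0 + s))) (sum-tabulate-zero (row (suc (suc zero)) ∘ leaf) (λ _ → refl)) ⟩
    2                                                            ∎

  deg-leaf : ∀ i → deg T (leaf i) ≡ 1
  deg-leaf i = begin
    deg T (leaf i)                           ≡⟨ deg-tabulate T (leaf i) ⟩
    1 + sum (tabulate (row (leaf i) ∘ suc))  ≡⟨ cong (_+_ 1) (sum-tabulate-zero (row (leaf i) ∘ suc) (λ _ → refl)) ⟩
    1                                        ∎

  deg-cases : ∀ i → (deg T i ≡ 1) ⊎ (deg T i ≡ 2) ⊎ (deg T i ≡ Δ)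
  deg-cases zero                = inj₂ (inj₂ deg-apex)
  deg-cases (suc zero)          = inj₂ (inj₁ deg-corner₁)
  deg-cases (suc (suc zero))    = inj₂ (inj₁ deg-corner₂)
  deg-cases (suc (suc (suc i))) = inj₁ (deg-leaf i)

  degrees-T : degrees T ≡ Δ ∷ 2 ∷ 2 ∷ replicate (ℕ.suc k) 1
  degrees-T = trans (List.map-tabulate (λ i → i) (deg T))
    (cong₂ _∷_ deg-apex (cong₂ _∷_ deg-corner₁ (cong₂ _∷_ deg-corner₂ (tabulate-const (deg T ∘ leaf) deg-leaf))))

  forward : Fin (4 + k) → Fin (4 + k) → ℕ
  forward i j = if toℕ i <ᵇ toℕ j then row i j else 0

  edgeCount-T : edgeCount T ≡ 4 + k
  edgeCount-T = begin
    edgeCount T                                        ≡⟨ edgeCount-tabulate T ⟩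
    sum (tabulate (λ i → sum (tabulate (forward i))))  ≡⟨ cong₂ _+_ apex (cong₂ _+_ corner₁ (cong₂ _+_ corner₂ leaves)) ⟩
    Δ + (1 + (0 + 0))                                  ≡⟨ cong (_+_ 3) (ℕ.+-comm k 1) ⟩
    4 + k                                              ∎
    where
    apex : sum (tabulate (forward zero)) ≡ Δ
    apex = trans (sum-tabulate-const (forward zero ∘ suc) (λ _ → refl)) (ℕ.*-identityʳ Δ)
    corner₁ : sum (tabulate (forward (suc zero))) ≡ 1
    corner₁ = cong ℕ.suc (sum-tabulate-zero (forward (suc zero) ∘ leaf) (λ _ → refl))
    corner₂ : sum (tabulate (forward (suc (suc zero)))) ≡ 0
    corner₂ = sum-tabulate-zero (forward (suc (suc zero)) ∘ leaf) (λ _ → refl)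
    leaves : sum (tabulate (λ i → sum (tabulate (forward (leaf i))))) ≡ 0
    -- a leaf is adjacent only to the apex, which precedes it
    leaves = sum-tabulate-zero (λ i → sum (tabulate (forward (leaf i))))
               (λ i → sum-tabulate-zero (forward (leaf i)) λ { zero → refl ; (suc j) → if-eta _ })

  maxDeg-T : maxDeg T ≡ Δ
  maxDeg-T = trans (cong (foldr _⊔_ 0) degrees-T)
                   (cong (λ x → Δ ⊔ (2 ⊔ (2 ⊔ x))) (foldr-replicate _⊔_ ℕ.⊔-assoc ℕ.⊔-idem k 1 0))

  minDeg-T : minDeg T ≡ 1
  minDeg-T = trans (cong₂ (foldr _⊓_) maxDeg-T degrees-T)
                   (cong (λ x → Δ ⊓ (2 ⊓ (2 ⊓ x))) (foldr-replicate _⊓_ ℕ.⊓-assoc ℕ.⊓-idem k 1 Δ))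

  N₁-T : N T 1 ≡ ℕ.suc k
  N₁-T = begin
    N T 1                                              ≡⟨ N-degrees T 1 ⟩
    count 1 (degrees T)                                ≡⟨ cong (count 1) degrees-T ⟩
    sum (map (indicator 1) (replicate (ℕ.suc k) 1))    ≡⟨ cong sum (List.map-replicate (indicator 1) (ℕ.suc k) 1) ⟩
    sum (replicate (ℕ.suc k) 1)                        ≡⟨ sum-replicate (ℕ.suc k) 1 ⟩
    ℕ.suc k * 1                                        ≡⟨ ℕ.*-identityʳ (ℕ.suc k) ⟩
    ℕ.suc k                                            ∎

  N-Δ-T : N T Δ ≡ 1
  N-Δ-T = begin
    N T Δ                                                          ≡⟨ N-degrees T Δ ⟩
    count Δ (degrees T)                                            ≡⟨ cong (count Δ) degrees-T ⟩
    indicator Δ Δ + sum (map (indicator Δ) (replicate (ℕ.suc k) 1))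
      ≡⟨ cong₂ _+_ (cong (if_then 1 else 0) (≡ᵇ-refl Δ)) (cong sum (List.map-replicate (indicator Δ) (ℕ.suc k) 1)) ⟩
    1 + sum (replicate (ℕ.suc k) 0)                                ≡⟨ cong (_+_ 1) (trans (sum-replicate (ℕ.suc k) 0) (ℕ.*-zeroʳ (ℕ.suc k))) ⟩
    1                                                              ∎

  S-T : S T ≡ ℕ→ℚ (2 * N T 1)
  S-T = begin
    S T                                                                ≡⟨ S-unicyclic T edgeCount-T ⟩
    ℕ→ℚ (sum (map dist2 (degrees T)))                                  ≡⟨ cong (ℕ→ℚ ∘ sum ∘ map dist2) degrees-T ⟩
    ℕ→ℚ (ℕ.suc k + sum (map dist2 (replicate (ℕ.suc k) 1)))            ≡⟨ cong (λ s → ℕ→ℚ (ℕ.suc k + s)) leaves ⟩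
    ℕ→ℚ (2 * ℕ.suc k)                                                  ≡⟨ cong (λ x → ℕ→ℚ (2 * x)) N₁-T ⟨
    ℕ→ℚ (2 * N T 1)                                                    ∎
    where
    dist2 : ℕ → ℕ
    dist2 d = ℕ.∣ d - 2 ∣
    leaves : sum (map dist2 (replicate (ℕ.suc k) 1)) ≡ ℕ.suc k + 0
    leaves = trans (cong sum (List.map-replicate dist2 (ℕ.suc k) 1))
                   (trans (sum-replicate (ℕ.suc k) 1) (trans (ℕ.*-identityʳ (ℕ.suc k)) (sym (ℕ.+-identityʳ (ℕ.suc k)))))

  irregularity-T : divℕ (ℕ→ℚ (2 * N T Δ * N T 1)) (N T Δ + N T 1) ℚ.* (ℕ→ℚ Δ ℚ.- ℕ→ℚ 1) ≡ ℕ→ℚ (2 * N T 1)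
  irregularity-T = begin
    divℕ (ℕ→ℚ (2 * N T Δ * N T 1)) (N T Δ + N T 1) ℚ.* (ℕ→ℚ Δ ℚ.- ℕ→ℚ 1)
      ≡⟨ cong₂ (λ a b → divℕ (ℕ→ℚ (2 * a * b)) (a + b) ℚ.* (ℕ→ℚ Δ ℚ.- ℕ→ℚ 1)) N-Δ-T N₁-T ⟩
    divℕ (ℕ→ℚ (2 * ℕ.suc k)) (2 + k) ℚ.* (ℕ→ℚ (1 + (2 + k)) ℚ.- ℕ→ℚ 1)
      ≡⟨ cong (divℕ (ℕ→ℚ (2 * ℕ.suc k)) (2 + k) ℚ.*_) (ℕ→ℚ-+-cancelˡ 1 (2 + k)) ⟩
    divℕ (ℕ→ℚ (2 * ℕ.suc k)) (2 + k) ℚ.* ℕ→ℚ (2 + k)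
      ≡⟨ divℕ-*-cancel (ℕ→ℚ (2 * ℕ.suc k)) (ℕ.suc k) ⟩
    ℕ→ℚ (2 * ℕ.suc k)
      ≡⟨ cong (λ x → ℕ→ℚ (2 * x)) N₁-T ⟨
    ℕ→ℚ (2 * N T 1)
      ∎

proposition31 : (k : ℕ) →
    Σ ℕ λ n → Σ (Graph n) λ G → Σ ℕ λ Δ →
    n ≥ k × Unicyclic G × Δ ≥ 3 ×
    (∀ i → (deg G i ≡ 1) ⊎ (deg G i ≡ 2) ⊎ (deg G i ≡ Δ)) ×
    (∃ λ (i : Fin n) → deg G i ≡ 1) ×
    (∃ λ (i : Fin n) → deg G i ≡ 2) ×
    (∃ λ (i : Fin n) → deg G i ≡ Δ) ×
    S G ≡ IRD G ×
    IRD G ≡ divℕ (ℕ→ℚ (2 * N G Δ * N G 1)) (N G Δ + N G 1) ℚ.* (ℕ→ℚ Δ ℚ.- ℕ→ℚ 1) ×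
    divℕ (ℕ→ℚ (2 * N G Δ * N G 1)) (N G Δ + N G 1) ℚ.* (ℕ→ℚ Δ ℚ.- ℕ→ℚ 1) ≡ ℕ→ℚ (2 * N G 1)
proposition31 k =
  4 + k , T , Δ , ℕ.m≤n+m k 4 , (cone-connected (singleEdge Δ) , edgeCount-T) , ℕ.m≤m+n 3 k ,
  deg-cases , (leaf zero , deg-leaf zero) , (suc zero , deg-corner₁) , (zero , deg-apex) ,
  trans S-T (sym (trans IRD-T irregularity-T)) , IRD-T , irregularity-T
  where
  open PendantTriangle k
  IRD-T : IRD T ≡ divℕ (ℕ→ℚ (2 * N T Δ * N T 1)) (N T Δ + N T 1) ℚ.* (ℕ→ℚ Δ ℚ.- ℕ→ℚ 1)
  IRD-T = IRD-extremes T maxDeg-T minDeg-T
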